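{- Let $s\ge 2$ be an integer and let $d\ge 3$ be an odd integer. Then there exist integers $s'=s'(s,d)$ and $d'=d'(s,d)$ with $1\le d'\le d$ such that for every positive integer $n$, $$\nu_d(f_n(s,-1))=\delta_{d'\mathbb{Z}}(n)\,\nu_d\!\left(\frac{s'n}{d'}\right).$$
   Context: For integers $s,t$, the generalized Fibonacci sequence is $f_0(s,t)=0$, $f_1(s,t)=1$, $f_n(s,t)=s f_{n-1}(s,t)+t f_{n-2}(s,t)$ for $n\ge2$. If $d=p_1^{\alpha_1}\cdots p_k^{\alpha_k}$ is the prime factorization of $d$, then for a nonzero rational $q$, $\nu_d(q)=\min_{1\le i\le k}\lfloor \nu_{p_i}(q)/\alpha_i\rfloor$, where $\nu_{p_i}$ is the $p_i$-adic valuation; for a nonzero integer $N$ this is the largest $k$ with $d^k\mid N$. For a positive integer $d'$, $\delta_{d'\mathbb{Z}}(n)$ equals $1$ if $d'\mid n$ and $0$ otherwise. -}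

module Defs where

open import Data.Nat as ℕ using (ℕ; zero; suc)
open import Data.Nat.Divisibility using (_∣?_)
open import Data.Nat.Primality using (prime?)
open import Data.Integer as ℤ using (ℤ; +_; ∣_∣; _⊓_)
open import Data.Integer.DivMod using (_/ℕ_)
open import Data.Rational using (ℚ; ↥_; ↧ₙ_)
open import Data.List using (List; []; _∷_; foldr; filter; upTo; map)
open import Relation.Nullary using (does)
open import Relation.Nullary.Decidable using (_×-dec_)
open import Data.Bool using (if_then_else_)

fib : ℤ → ℤ → ℕ → ℤ
fib s t zero = + 0
fib s t (suc zero) = + 1
fib s t (suc (suc n)) = s ℤ.* fib s t (suc n) ℤ.+ t ℤ.* fib s t n

-- Computed with fuel (fuel = N suffices,
-- since e ≤ N).  Degenerate inputs (p < 2 or N = 0) give 0; they are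
-- never used in the statement.
vpFuel : ℕ → ℕ → ℕ → ℕ
vpFuel zero fuel N = 0
vpFuel (suc zero) fuel N = 0
vpFuel (suc (suc q)) zero N = 0
vpFuel (suc (suc q)) (suc fuel) zero = 0
vpFuel (suc (suc q)) (suc fuel) (suc N) =
  if does (suc (suc q) ∣? suc N)
  then suc (vpFuel (suc (suc q)) fuel (suc N ℕ./ suc (suc q)))
  else 0

vpℕ : ℕ → ℕ → ℕ
vpℕ p N = vpFuel p N N

vpℚ : ℕ → ℚ → ℤ
vpℚ p q = + vpℕ p ∣ ↥ q ∣ ℤ.- + vpℕ p (↧ₙ q)

-- floor of x / α for α ≥ 1 (α = 0 is degenerate and never used)
floorDiv : ℤ → ℕ → ℤ
floorDiv x zero = + 0
floorDiv x (suc a) = x /ℕ suc a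

-- primes dividing d (those are all ≤ d for d ≥ 1)
primeDivisors : ℕ → List ℕ
primeDivisors d = filter (λ p → prime? p ×-dec (p ∣? d)) (upTo (suc d))

minList : List ℤ → ℤ
minList [] = + 0
minList (x ∷ xs) = foldr _⊓_ x xs

-- ν_d(q) = min over primes p ∣ d of ⌊ν_p(q) / α_p⌋, α_p = ν_p(d)
-- (used for d ≥ 2, so the list of prime divisors is nonempty)
νd : ℕ → ℚ → ℤ
νd d q = minList (map (λ p → floorDiv (vpℚ p q) (vpℕ p d)) (primeDivisors d))

δ : ℕ → ℕ → ℤ
δ d' n = if does (d' ∣? n) then + 1 else + 0

module Submission where

-- Let U n = f_n(s,-1) and let d be odd.  We take d' = the least n ≥ 1 such that every prime
-- p ∣ d divides U n, and s' = U d'.  The proof is developed for any parameter t with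
-- U t n ≠ 0 for n ≥ 1 (which holds for t ≥ 2):
--
-- 1. Algebra of the Lucas sequence U (parameter t): addition formulas, the Cassini invariant,
--    and the multiplication formula U (k m) = U m · U_{V m} k with V m = 2 U (m+1) - t U m.
-- 2. Lifting the exponent: if p is an odd prime with p ∣ U m then V m ≡ ±2 (mod p²), so
--    U_{V m} k ≡ ±k (mod p, resp. p² for k = p); hence ν_p (U (k m)) = ν_p (U m) + ν_p k.
-- 3. Rank of apparition: by pigeonhole on the p+1 "slopes" of consecutive pairs of terms,
--    every odd prime p divides some U n with 1 ≤ n ≤ p.  Multiplying these ranks over the
--    prime factorisation of d gives an index N ≤ d where all primes of d divide U N, so d' ≤ d.
-- 4. The indices n where all primes of d divide U n are closed under multiples and
--    differences (U is a divisibility sequence), so they are exactly the multiples of d'.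
-- 5. Theorem: if d' ∤ n some ν_p (U n) vanishes and ν_d (U n) = 0; if n = c d', then by 2
--    ν_p (U n) = ν_p s' + ν_p c = ν_p (s' n / d') for every p ∣ d, so the two ν_d agree.

open import Defs
open import Data.Nat as ℕ using (ℕ; zero; suc; 2+; _≤_; _<_; _∸_; z≤n; s≤s; >-nonZero)
import Data.Nat.Properties as ℕP
open import Data.Nat.Divisibility using (_∣_)
import Data.Nat.Divisibility as ℕD
open import Data.Nat.DivMod using (_%_; _/_; m≡m%n+[m/n]*n; m%n<n; m/n*n≤m; m*[n/m]≡n; m/n<m)
open import Data.Nat.Induction using (<-rec)
open import Data.Nat.Coprimality using (Coprime; coprime-Bézout)
open import Data.Nat.GCD using (module Bézout)
open import Data.Nat.Primality
  using (Prime; prime?; euclidsLemma; prime⇒irreducible; prime⇒nonZero; prime⇒nonTrivial)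
open import Data.Nat.Primality.Factorisation using (factorise; PrimeFactorisation)
open import Data.Nat.ListAction using (product)
import Data.Nat.Tactic.RingSolver as ℕSolver
open import Data.Integer as ℤ using (ℤ; +_; -_; _+_; _*_; _-_)
import Data.Integer.Properties as ℤP
open import Data.Integer.Divisibility.Signed as ℤD
  using (divides; ∣m∣n⇒∣m+n; ∣m∣n⇒∣m-n; ∣m⇒∣-m; ∣n⇒∣m*n; ∣m⇒∣m*n; ∣ᵤ⇒∣; ∣⇒∣ᵤ)
  renaming (_∣_ to _∣ℤ_)
open import Data.Integer.DivMod using (_%ℕ_; _/ℕ_; a≡a%ℕn+[a/ℕn]*n; n%ℕd<d)
import Data.Integer.GCD as ℤGCD
open import Data.Integer.Tactic.RingSolver using (solve-∀)
open import Data.Rational as ℚ using (ℚ)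
import Data.Rational.Properties as ℚP
open import Data.Fin as Fin using (Fin)
import Data.Fin.Properties as FinP
open import Data.List using (List; []; _∷_; foldr; map; upTo)
open import Data.List.Properties using (map-cong-local)
open import Data.List.Membership.Propositional using (_∈_; find)
open import Data.List.Membership.Propositional.Properties using (∈-filter⁻; ∈-map⁺)
open import Data.List.Relation.Unary.Any using (here; there)
open import Data.List.Relation.Unary.All as All using (All; []; _∷_)
open import Data.List.Relation.Unary.All.Properties using (¬All⇒Any¬; map⁺)
open import Data.Bool using (if_then_else_)
open import Data.Product using (Σ; ∃; ∃-syntax; _×_; _,_; proj₁; proj₂)
open import Data.Sum using (_⊎_; inj₁; inj₂)
open import Data.Empty using (⊥; ⊥-elim)
open import Relation.Nullary using (¬_; Dec; yes; no)
open import Relation.Nullary.Decidable using (_×-dec_; dec-true; dec-false)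
open import Relation.Binary using (tri<; tri≈; tri>)
open import Relation.Binary.PropositionalEquality
  using (_≡_; _≢_; refl; sym; trans; cong; cong₂; subst; module ≡-Reasoning)

U : ℤ → ℕ → ℤ
U t = fib t (- + 1)

U-rec : ∀ t n → U t (suc (suc n)) ≡ t * U t (suc n) - U t n
U-rec t n = ring t (U t (suc n)) (U t n)
  where ring : ∀ t a b → t * a + - + 1 * b ≡ t * a - b
        ring = solve-∀

U-add : ∀ t a b → U t (suc (a ℕ.+ b)) ≡ U t (suc a) * U t (suc b) - U t a * U t b
U-add t zero b = ring (U t (suc b)) (U t b)
  where ring : ∀ x y → x ≡ + 1 * x - + 0 * y
        ring = solve-∀
U-add t (suc zero) b = trans (U-rec t b) (ring t (U t (suc b)) (U t b))
  where ring : ∀ t x y → t * x - y ≡ (t * + 1 + - + 1 * + 0) * x - + 1 * y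
        ring = solve-∀
U-add t (suc (suc a)) b = begin
    U t (suc (suc (suc (a ℕ.+ b))))
      ≡⟨ U-rec t (suc (a ℕ.+ b)) ⟩
    t * U t (suc (suc (a ℕ.+ b))) - U t (suc (a ℕ.+ b))
      ≡⟨ cong₂ (λ x y → t * x - y) (U-add t (suc a) b) (U-add t a b) ⟩
    t * (U t (2+ a) * U t (suc b) - U t (suc a) * U t b) - (U t (suc a) * U t (suc b) - U t a * U t b)
      ≡⟨ ring t (U t (2+ a)) (U t (suc a)) (U t a) (U t (suc b)) (U t b) ⟩
    (t * U t (2+ a) - U t (suc a)) * U t (suc b) - (t * U t (suc a) - U t a) * U t b
      ≡⟨ sym (cong₂ (λ x y → x * U t (suc b) - y * U t b) (U-rec t (suc a)) (U-rec t a)) ⟩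
    U t (suc (2+ a)) * U t (suc b) - U t (2+ a) * U t b ∎
  where
  open ≡-Reasoning
  ring : ∀ t x y z u v → t * (x * u - y * v) - (y * u - z * v) ≡ (t * x - y) * u - (t * y - z) * v
  ring = solve-∀

U-shift : ∀ t i k → U t (suc i) * U t (i ℕ.+ k) - U t i * U t (suc (i ℕ.+ k)) ≡ U t k
U-shift t zero k = ring (U t k) (U t (suc k))
  where ring : ∀ x y → + 1 * x - + 0 * y ≡ x
        ring = solve-∀
U-shift t (suc i) k = begin
    U t (2+ i) * U t (suc (i ℕ.+ k)) - U t (suc i) * U t (2+ (i ℕ.+ k))
      ≡⟨ cong₂ (λ x y → x * U t (suc (i ℕ.+ k)) - U t (suc i) * y) (U-rec t i) (U-rec t (i ℕ.+ k)) ⟩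
    (t * U t (suc i) - U t i) * U t (suc (i ℕ.+ k)) - U t (suc i) * (t * U t (suc (i ℕ.+ k)) - U t (i ℕ.+ k))
      ≡⟨ ring t (U t (suc i)) (U t i) (U t (suc (i ℕ.+ k))) (U t (i ℕ.+ k)) ⟩
    U t (suc i) * U t (i ℕ.+ k) - U t i * U t (suc (i ℕ.+ k))
      ≡⟨ U-shift t i k ⟩
    U t k ∎
  where
  open ≡-Reasoning
  ring : ∀ t x y u v → (t * x - y) * u - x * (t * u - v) ≡ x * v - y * u
  ring = solve-∀

U-gap : ∀ t i j → i ≤ j → U t (suc i) * U t j - U t i * U t (suc j) ≡ U t (j ∸ i)
U-gap t i j i≤j = trans (cong (λ z → U t (suc i) * U t z - U t i * U t (suc z)) (sym (ℕP.m+[n∸m]≡n i≤j)))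
                        (U-shift t i (j ∸ i))

U-cassini : ∀ t n → U t (suc n) * U t (suc n) - t * U t (suc n) * U t n + U t n * U t n ≡ + 1
U-cassini t zero = ring t
  where ring : ∀ t → + 1 * + 1 - t * + 1 * + 0 + + 0 * + 0 ≡ + 1
        ring = solve-∀
U-cassini t (suc n) = begin
    U t (2+ n) * U t (2+ n) - t * U t (2+ n) * U t (suc n) + U t (suc n) * U t (suc n)
      ≡⟨ cong (λ x → x * x - t * x * U t (suc n) + U t (suc n) * U t (suc n)) (U-rec t n) ⟩
    (t * b - a) * (t * b - a) - t * (t * b - a) * b + b * b
      ≡⟨ ring t b a ⟩
    b * b - t * b * a + a * a
      ≡⟨ U-cassini t n ⟩
    + 1 ∎
  where
  open ≡-Reasoning
  b = U t (suc n)
  a = U t n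
  ring : ∀ t b a → (t * b - a) * (t * b - a) - t * (t * b - a) * b + b * b ≡ b * b - t * b * a + a * a
  ring = solve-∀

V : ℤ → ℕ → ℤ
V t m = + 2 * U t (suc m) - t * U t m

U-step : ∀ t n m → U t (n ℕ.+ (m ℕ.+ m)) + U t n ≡ V t m * U t (n ℕ.+ m)
U-step t zero zero = ring (V t zero)
  where ring : ∀ v → + 0 + + 0 ≡ v * + 0
        ring = solve-∀
U-step t zero (suc m) = begin
    U t (suc (m ℕ.+ suc m)) + + 0
      ≡⟨ cong (_+ + 0) (U-add t m (suc m)) ⟩
    x * U t (2+ m) - y * x + + 0
      ≡⟨ cong (λ z → x * z - y * x + + 0) (U-rec t m) ⟩
    x * (t * x - y) - y * x + + 0
      ≡⟨ ring t x y ⟩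
    (+ 2 * (t * x - y) - t * x) * x
      ≡⟨ cong (λ z → (+ 2 * z - t * x) * x) (sym (U-rec t m)) ⟩
    V t (suc m) * x ∎
  where
  open ≡-Reasoning
  x = U t (suc m)
  y = U t m
  ring : ∀ t x y → x * (t * x - y) - y * x + + 0 ≡ (+ 2 * (t * x - y) - t * x) * x
  ring = solve-∀
U-step t (suc zero) m = begin
    U t (suc (m ℕ.+ m)) + + 1
      ≡⟨ cong₂ _+_ (U-add t m m) (sym (U-cassini t m)) ⟩
    x * x - y * y + (x * x - t * x * y + y * y)
      ≡⟨ ring t x y ⟩
    V t m * x ∎
  where
  open ≡-Reasoning
  x = U t (suc m)
  y = U t m
  ring : ∀ t x y → x * x - y * y + (x * x - t * x * y + y * y) ≡ (+ 2 * x - t * y) * x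
  ring = solve-∀
U-step t (suc (suc n)) m = begin
    U t (2+ (n ℕ.+ (m ℕ.+ m))) + U t (2+ n)
      ≡⟨ cong₂ _+_ (U-rec t (n ℕ.+ (m ℕ.+ m))) (U-rec t n) ⟩
    (t * U t (suc (n ℕ.+ (m ℕ.+ m))) - U t (n ℕ.+ (m ℕ.+ m))) + (t * U t (suc n) - U t n)
      ≡⟨ ring₁ t (U t (suc (n ℕ.+ (m ℕ.+ m)))) (U t (n ℕ.+ (m ℕ.+ m))) (U t (suc n)) (U t n) ⟩
    t * (U t (suc (n ℕ.+ (m ℕ.+ m))) + U t (suc n)) - (U t (n ℕ.+ (m ℕ.+ m)) + U t n)
      ≡⟨ cong₂ (λ x y → t * x - y) (U-step t (suc n) m) (U-step t n m) ⟩
    t * (V t m * U t (suc (n ℕ.+ m))) - V t m * U t (n ℕ.+ m)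
      ≡⟨ ring₂ t (V t m) (U t (suc (n ℕ.+ m))) (U t (n ℕ.+ m)) ⟩
    V t m * (t * U t (suc (n ℕ.+ m)) - U t (n ℕ.+ m))
      ≡⟨ cong (V t m *_) (sym (U-rec t (n ℕ.+ m))) ⟩
    V t m * U t (2+ (n ℕ.+ m)) ∎
  where
  open ≡-Reasoning
  ring₁ : ∀ t a b c e → t * a - b + (t * c - e) ≡ t * (a + c) - (b + e)
  ring₁ = solve-∀
  ring₂ : ∀ t v x y → t * (v * x) - v * y ≡ v * (t * x - y)
  ring₂ = solve-∀

-- Multiplication formula: U (k m) = U m · U_{V m} k.  In particular U is a
-- divisibility sequence, and the p-adic behaviour of U (k m) reduces to that
-- of the Lucas sequence with parameter V m.
U-mul : ∀ t k m → U t (k ℕ.* m) ≡ U t m * U (V t m) k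
U-mul t zero m = sym (ℤP.*-zeroʳ (U t m))
U-mul t (suc zero) m = trans (cong (U t) (ℕP.+-identityʳ m)) (sym (ℤP.*-identityʳ (U t m)))
U-mul t (suc (suc k)) m = begin
    U t (m ℕ.+ (m ℕ.+ k ℕ.* m))
      ≡⟨ cong (U t) (trans (sym (ℕP.+-assoc m m (k ℕ.* m))) (ℕP.+-comm (m ℕ.+ m) (k ℕ.* m))) ⟩
    U t (k ℕ.* m ℕ.+ (m ℕ.+ m))
      ≡⟨ ring₁ (U t (k ℕ.* m ℕ.+ (m ℕ.+ m))) (U t (k ℕ.* m)) ⟩
    (U t (k ℕ.* m ℕ.+ (m ℕ.+ m)) + U t (k ℕ.* m)) - U t (k ℕ.* m)
      ≡⟨ cong₂ _-_ (U-step t (k ℕ.* m) m) (U-mul t k m) ⟩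
    v * U t (k ℕ.* m ℕ.+ m) - U t m * U v k
      ≡⟨ cong (λ z → v * U t z - U t m * U v k) (ℕP.+-comm (k ℕ.* m) m) ⟩
    v * U t (m ℕ.+ k ℕ.* m) - U t m * U v k
      ≡⟨ cong (λ z → v * z - U t m * U v k) (U-mul t (suc k) m) ⟩
    v * (U t m * U v (suc k)) - U t m * U v k
      ≡⟨ ring₂ (U t m) v (U v (suc k)) (U v k) ⟩
    U t m * (v * U v (suc k) - U v k)
      ≡⟨ cong (U t m *_) (sym (U-rec v k)) ⟩
    U t m * U v (2+ k) ∎
  where
  open ≡-Reasoning
  v = V t m
  ring₁ : ∀ a b → a ≡ (a + b) - b
  ring₁ = solve-∀
  ring₂ : ∀ y v a b → v * (y * a) - y * b ≡ y * (v * a - b)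
  ring₂ = solve-∀

-- V m ² - 4 = (t² - 4) U m ²: a prime dividing U m forces V m ≡ ±2.
V-square : ∀ t m → V t m * V t m - + 4 ≡ (t * t - + 4) * (U t m * U t m)
V-square t m = begin
    V t m * V t m - + 4
      ≡⟨ cong (λ z → V t m * V t m - + 4 * z) (sym (U-cassini t m)) ⟩
    V t m * V t m - + 4 * (x * x - t * x * y + y * y)
      ≡⟨ ring t x y ⟩
    (t * t - + 4) * (y * y) ∎
  where
  open ≡-Reasoning
  x = U t (suc m)
  y = U t m
  ring : ∀ t x y → (+ 2 * x - t * y) * (+ 2 * x - t * y) - + 4 * (x * x - t * x * y + y * y)
                   ≡ (t * t - + 4) * (y * y)
  ring = solve-∀

Nondegenerate : ℤ → Set
Nondegenerate t = ∀ n → 1 ≤ n → 1 ≤ ℤ.∣ U t n ∣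

U-increasing : ∀ c n → ∃[ a ] ∃[ b ] U (+ 2 + + c) n ≡ + a × U (+ 2 + + c) (suc n) ≡ + a + + suc b
U-increasing c zero = 0 , 0 , refl , refl
U-increasing c (suc n) with U-increasing c n
... | a , b , Un , Usn = a ℕ.+ suc b , b ℕ.+ c ℕ.* (a ℕ.+ suc b) , Usn , Ussn
  where
  open ≡-Reasoning
  t = + 2 + + c
  ring : ∀ c a b → (+ 2 + c) * (a + b) - a ≡ (a + b) + (b + c * (a + b))
  ring = solve-∀
  Ussn : U t (2+ n) ≡ + (a ℕ.+ suc b) + + suc (b ℕ.+ c ℕ.* (a ℕ.+ suc b))
  Ussn = begin
    U t (2+ n)                                           ≡⟨ U-rec t n ⟩
    t * U t (suc n) - U t n                              ≡⟨ cong₂ (λ x y → t * x - y) Usn Un ⟩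
    t * (+ a + + suc b) - + a                            ≡⟨ ring (+ c) (+ a) (+ suc b) ⟩
    (+ a + + suc b) + (+ suc b + + c * (+ a + + suc b))
      ≡⟨ cong (λ z → (+ a + + suc b) + (+ suc b + z)) (sym (ℤP.pos-* c (a ℕ.+ suc b))) ⟩
    + (a ℕ.+ suc b) + + suc (b ℕ.+ c ℕ.* (a ℕ.+ suc b)) ∎

nondegenerate : ∀ t → + 2 ℤ.≤ t → Nondegenerate t
nondegenerate (+ (2+ c)) (ℤ.+≤+ (s≤s (s≤s _))) (suc n) _ with U-increasing c n
... | a , b , _ , Usn rewrite Usn = ℕP.≤-trans (s≤s z≤n) (ℕP.m≤n+m (suc b) a)

U-cong : ∀ {M a b} → M ∣ℤ a - b → ∀ k → M ∣ℤ U a k - U b k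
U-cong {M} h zero = divides (+ 0) (sym (ℤP.*-zeroˡ M))
U-cong {M} h (suc zero) = divides (+ 0) (sym (ℤP.*-zeroˡ M))
U-cong {M} {a} {b} h (suc (suc k)) =
  subst (M ∣ℤ_) (sym split)
    (∣m∣n⇒∣m-n (∣m∣n⇒∣m+n (∣n⇒∣m*n a (U-cong h (suc k))) (∣m⇒∣m*n (U b (suc k)) h)) (U-cong h k))
  where
  ring : ∀ a b x y u v → a * x - u - (b * y - v) ≡ a * (x - y) + (a - b) * y - (u - v)
  ring = solve-∀
  split : U a (2+ k) - U b (2+ k)
          ≡ a * (U a (suc k) - U b (suc k)) + (a - b) * U b (suc k) - (U a k - U b k)
  split = trans (cong₂ _-_ (U-rec a k) (U-rec b k)) (ring a b _ _ _ _)

infix 4 _≡±_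
_≡±_ : ℤ → ℤ → Set
x ≡± y = x ≡ y ⊎ x ≡ - y

∣∣-≡± : ∀ {x n} → x ≡± + n → ℤ.∣ x ∣ ≡ n
∣∣-≡± (inj₁ refl) = refl
∣∣-≡± {n = n} (inj₂ refl) = ℤP.∣-i∣≡∣i∣ (+ n)

U-two : ∀ k → U (+ 2) k ≡ + k
U-two zero = refl
U-two (suc zero) = refl
U-two (suc (suc k)) =
  trans (U-rec (+ 2) k) (trans (cong₂ (λ x y → + 2 * x - y) (U-two (suc k)) (U-two k)) (ring (+ k)))
  where ring : ∀ x → + 2 * (+ 1 + x) - x ≡ + 1 + (+ 1 + x)
        ring = solve-∀

U-neg : ∀ t k → (U (- t) k ≡ U t k × U (- t) (suc k) ≡ - U t (suc k))
              ⊎ (U (- t) k ≡ - U t k × U (- t) (suc k) ≡ U t (suc k))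
U-neg t zero = inj₂ (refl , refl)
U-neg t (suc k) with U-neg t k
... | inj₁ (e₀ , e₁) = inj₂ (e₁ , trans (U-rec (- t) k)
        (trans (cong₂ (λ x y → - t * x - y) e₁ e₀) (trans (ring t _ _) (sym (U-rec t k)))))
  where ring : ∀ t x y → - t * - x - y ≡ t * x - y
        ring = solve-∀
... | inj₂ (e₀ , e₁) = inj₁ (e₁ , trans (U-rec (- t) k)
        (trans (cong₂ (λ x y → - t * x - y) e₁ e₀) (trans (ring t _ _) (cong -_ (sym (U-rec t k))))))
  where ring : ∀ t x y → - t * x - - y ≡ - (t * x - y)
        ring = solve-∀

U-±2 : ∀ {c} → c ≡± + 2 → ∀ k → U c k ≡± + k
U-±2 (inj₁ refl) k = inj₁ (U-two k)
U-±2 (inj₂ refl) k with U-neg (+ 2) k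
... | inj₁ (e , _) = inj₁ (trans e (U-two k))
... | inj₂ (e , _) = inj₂ (trans e (cong -_ (U-two k)))

prime⇒2≤ : ∀ {p} → Prime p → 2 ≤ p
prime⇒2≤ {p} pr = ℕ.nonTrivial⇒n>1 p {{prime⇒nonTrivial pr}}

prime-∣ℤ-* : ∀ {p} x y → Prime p → + p ∣ℤ x * y → + p ∣ℤ x ⊎ + p ∣ℤ y
prime-∣ℤ-* {p} x y pr h
  with euclidsLemma ℤ.∣ x ∣ ℤ.∣ y ∣ pr (subst (p ∣_) (ℤP.abs-* x y) (∣⇒∣ᵤ h))
... | inj₁ a = inj₁ (∣ᵤ⇒∣ a)
... | inj₂ b = inj₂ (∣ᵤ⇒∣ b)

∣ℤ-≡± : ∀ {p x n} → x ≡± + n → + p ∣ℤ x → p ∣ n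
∣ℤ-≡± {p} x±n h = subst (p ∣_) (∣∣-≡± x±n) (∣⇒∣ᵤ h)

prime∤1 : ∀ {p} → Prime p → ¬ p ∣ 1
prime∤1 pr h = ℕP.<⇒≢ (prime⇒2≤ pr) (sym (ℕD.∣1⇒≡1 h))

oddPrime∤4 : ∀ {p} → Prime p → p ≢ 2 → ¬ p ∣ 4
oddPrime∤4 {p} pr p≢2 h with euclidsLemma 2 2 pr h
... | inj₁ p∣2 = p≢2 (ℕP.≤-antisym (ℕD.∣⇒≤ p∣2) (prime⇒2≤ pr))
... | inj₂ p∣2 = p≢2 (ℕP.≤-antisym (ℕD.∣⇒≤ p∣2) (prime⇒2≤ pr))

ExactPower : ℕ → ℕ → ℕ → Set
ExactPower p v N = p ℕ.^ v ∣ N × ¬ p ℕ.^ suc v ∣ N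

vpFuel-exact : ∀ q f N → 1 ≤ N → N ≤ f → ExactPower (2+ q) (vpFuel (2+ q) f N) N
vpFuel-exact q (suc f) (suc N) _ (s≤s N≤f) with 2+ q ℕD.∣? suc N
... | no p∤N = subst (λ v → ExactPower (2+ q) v (suc N)) (sym vp≡0)
                     (ℕD.1∣ _ , λ h → p∤N (subst (_∣ suc N) (ℕP.*-identityʳ (2+ q)) h))
  where vp≡0 : vpFuel (2+ q) (suc f) (suc N) ≡ 0
        vp≡0 = cong (λ b → if b then suc (vpFuel (2+ q) f (suc N ℕ./ 2+ q)) else 0)
                     (dec-false (2+ q ℕD.∣? suc N) p∤N)
... | yes p∣N = subst (λ v → ExactPower (2+ q) v (suc N)) (sym vp≡suc) (p^suc∣N , p^2+∤N)
  where
  p = 2+ q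
  N' = suc N ℕ./ p
  N≡pN' : p ℕ.* N' ≡ suc N
  N≡pN' = m*[n/m]≡n p∣N
  N'≥1 : 1 ≤ N'
  N'≥1 = ℕP.n≢0⇒n>0 λ N'≡0 →
    ℕP.0≢1+n (trans (sym (ℕP.*-zeroʳ p)) (subst (λ z → p ℕ.* z ≡ suc N) N'≡0 N≡pN'))
  IH = vpFuel-exact q f N' N'≥1 (ℕP.≤-trans (ℕP.<⇒≤pred (m/n<m (suc N) p (s≤s (s≤s z≤n)))) N≤f)
  vp≡suc : vpFuel p (suc f) (suc N) ≡ suc (vpFuel p f N')
  vp≡suc = cong (λ b → if b then suc (vpFuel p f N') else 0) (dec-true (p ℕD.∣? suc N) p∣N)
  p^suc∣N : p ℕ.^ suc (vpFuel p f N') ∣ suc N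
  p^suc∣N = subst (p ℕ.^ suc (vpFuel p f N') ∣_) N≡pN' (ℕD.*-monoʳ-∣ p (proj₁ IH))
  p^2+∤N : ¬ p ℕ.^ 2+ (vpFuel p f N') ∣ suc N
  p^2+∤N h = proj₂ IH (ℕD.*-cancelˡ-∣ p (subst (p ℕ.^ 2+ (vpFuel p f N') ∣_) (sym N≡pN') h))

vp-exact : ∀ {p N} → 2 ≤ p → 1 ≤ N → ExactPower p (vpℕ p N) N
vp-exact {2+ q} {N} (s≤s (s≤s z≤n)) N≥1 = vpFuel-exact q N N N≥1 ℕP.≤-refl

^-monoʳ-∣ : ∀ p {a b} → a ≤ b → p ℕ.^ a ∣ p ℕ.^ b
^-monoʳ-∣ p {a} {b} a≤b = ℕD.divides (p ℕ.^ (b ∸ a))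
  (trans (cong (p ℕ.^_) (sym (ℕP.m+[n∸m]≡n a≤b)))
         (trans (ℕP.^-distribˡ-+-* p a (b ∸ a)) (ℕP.*-comm (p ℕ.^ a) _)))

ExactPower-unique : ∀ {p N v w} → ExactPower p v N → ExactPower p w N → v ≡ w
ExactPower-unique {p} {N} {v} {w} (p^v∣N , p^v+1∤N) (p^w∣N , p^w+1∤N) with ℕP.<-cmp v w
... | tri< v<w _ _ = ⊥-elim (p^v+1∤N (ℕD.∣-trans (^-monoʳ-∣ p v<w) p^w∣N))
... | tri≈ _ v≡w _ = v≡w
... | tri> _ _ w<v = ⊥-elim (p^w+1∤N (ℕD.∣-trans (^-monoʳ-∣ p w<v) p^v∣N))

vp-≡ : ∀ {p N v} → 2 ≤ p → 1 ≤ N → ExactPower p v N → vpℕ p N ≡ v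
vp-≡ p≥2 N≥1 = ExactPower-unique (vp-exact p≥2 N≥1)

vp-coprime : ∀ {p N} → 2 ≤ p → 1 ≤ N → ¬ p ∣ N → vpℕ p N ≡ 0
vp-coprime {p} {N} p≥2 N≥1 p∤N =
  vp-≡ p≥2 N≥1 (ℕD.1∣ N , λ h → p∤N (subst (_∣ N) (ℕP.*-identityʳ p) h))

vp-self : ∀ {p} → 2 ≤ p → vpℕ p p ≡ 1
vp-self {p} p≥2 = vp-≡ p≥2 (ℕP.≤-trans (s≤s z≤n) p≥2) (p∣p , p²∤p)
  where
  p∣p : p ℕ.^ 1 ∣ p
  p∣p = subst (_∣ p) (sym (ℕP.*-identityʳ p)) ℕD.∣-refl
  instance
    p≢0 : ℕ.NonZero p
    p≢0 = ℕ.>-nonZero (ℕP.≤-trans (s≤s z≤n) p≥2)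
  p²∤p : ¬ p ℕ.^ 2 ∣ p
  p²∤p h = ℕP.<⇒≱ (subst (p <_) (cong (p ℕ.*_) (sym (ℕP.*-identityʳ p))) (ℕP.m<m*n p p p≥2)) (ℕD.∣⇒≤ h)

1≤* : ∀ {a b} → 1 ≤ a → 1 ≤ b → 1 ≤ a ℕ.* b
1≤* {suc a} {suc b} _ _ = s≤s z≤n

1≤*⁻ : ∀ a b → 1 ≤ a ℕ.* b → 1 ≤ a × 1 ≤ b
1≤*⁻ (suc a) (suc b) _ = s≤s z≤n , s≤s z≤n
1≤*⁻ (suc a) zero h = ⊥-elim (ℕP.<⇒≱ h (ℕP.≤-reflexive (ℕP.*-zeroʳ (suc a))))

vp-* : ∀ {p a b} → Prime p → 1 ≤ a → 1 ≤ b → vpℕ p (a ℕ.* b) ≡ vpℕ p a ℕ.+ vpℕ p b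
vp-* {p} {a} {b} pr a≥1 b≥1 = vp-≡ p≥2 (1≤* a≥1 b≥1) (p^x+y∣ab , p^x+y+1∤ab)
  where
  p≥2 = prime⇒2≤ pr
  x = vpℕ p a
  y = vpℕ p b
  ea = vp-exact p≥2 a≥1
  eb = vp-exact p≥2 b≥1
  a' = ℕD.quotient (proj₁ ea)
  b' = ℕD.quotient (proj₁ eb)
  p∤cofactor : ∀ {v n} (h : ExactPower p v n) → ¬ p ∣ ℕD.quotient (proj₁ h)
  p∤cofactor {v} (p^v∣n , p^v+1∤n) (ℕD.divides c eq) =
    p^v+1∤n (ℕD.divides c (trans (ℕD.m∣n⇒n≡quotient*m p^v∣n)
                                 (trans (cong (ℕ._* p ℕ.^ v) eq) (ℕP.*-assoc c p (p ℕ.^ v)))))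
  ring : ∀ a' b' P Q → (a' ℕ.* P) ℕ.* (b' ℕ.* Q) ≡ (a' ℕ.* b') ℕ.* (P ℕ.* Q)
  ring = ℕSolver.solve-∀
  ab≡ : a ℕ.* b ≡ (a' ℕ.* b') ℕ.* p ℕ.^ (x ℕ.+ y)
  ab≡ = trans (cong₂ ℕ._*_ (ℕD.m∣n⇒n≡quotient*m (proj₁ ea)) (ℕD.m∣n⇒n≡quotient*m (proj₁ eb)))
         (trans (ring a' b' _ _) (cong ((a' ℕ.* b') ℕ.*_) (sym (ℕP.^-distribˡ-+-* p x y))))
  p^x+y∣ab : p ℕ.^ (x ℕ.+ y) ∣ a ℕ.* b
  p^x+y∣ab = subst (_∣ a ℕ.* b) (sym (ℕP.^-distribˡ-+-* p x y)) (ℕD.*-pres-∣ (proj₁ ea) (proj₁ eb))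
  p^x+y+1∤ab : ¬ p ℕ.^ suc (x ℕ.+ y) ∣ a ℕ.* b
  p^x+y+1∤ab h
    with euclidsLemma a' b' pr
           (ℕD.*-cancelʳ-∣ (p ℕ.^ (x ℕ.+ y)) {{ℕP.m^n≢0 p (x ℕ.+ y) {{prime⇒nonZero pr}}}}
             (subst (p ℕ.^ suc (x ℕ.+ y) ∣_) ab≡ h))
  ... | inj₁ p∣a' = p∤cofactor {x} ea p∣a'
  ... | inj₂ p∣b' = p∤cofactor {y} eb p∣b'

-- If a prime p divides U m, then V m ≡ ±2 (mod p), because V m ² - 4 = (t² - 4) U m ².
V-≡±2 : ∀ {p t m} → Prime p → + p ∣ℤ U t m → ∃[ c ] c ≡± + 2 × + p ∣ℤ V t m - c
V-≡±2 {p} {t} {m} pr p∣Um = sign (prime-∣ℤ-* (V t m - + 2) (V t m - - + 2) pr p∣product)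
  where
  ring : ∀ w → (w - + 2) * (w - - + 2) ≡ w * w - + 4
  ring = solve-∀
  p∣product : + p ∣ℤ (V t m - + 2) * (V t m - - + 2)
  p∣product = subst (+ p ∣ℤ_) (sym (trans (ring (V t m)) (V-square t m)))
                    (∣n⇒∣m*n (t * t - + 4) (∣m⇒∣m*n (U t m) p∣Um))
  sign : + p ∣ℤ V t m - + 2 ⊎ + p ∣ℤ V t m - - + 2 → ∃[ c ] c ≡± + 2 × + p ∣ℤ V t m - c
  sign (inj₁ h) = + 2 , inj₁ refl , h
  sign (inj₂ h) = - + 2 , inj₂ refl , h

≡±2-square : ∀ {c} → c ≡± + 2 → c * c ≡ + 4 × c + c ≡± + 4
≡±2-square (inj₁ refl) = refl , inj₁ refl
≡±2-square (inj₂ refl) = refl , inj₂ refl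

prime²-∣ : ∀ {p} x z → Prime p → + p * + p ∣ℤ x * z → + p ∣ℤ x → ¬ + p ∣ℤ z → + p * + p ∣ℤ x
prime²-∣ {p} x z pr p²∣xz (divides a x≡ap) p∤z =
  cases (prime-∣ℤ-* a z pr (ℤD.*-cancelˡ-∣ (+ p) {{prime⇒nonZero pr}} (subst (+ p * + p ∣ℤ_) xz≡ p²∣xz)))
  where
  ring₁ : ∀ a P z → a * P * z ≡ P * (a * z)
  ring₁ = solve-∀
  ring₂ : ∀ b P → b * P * P ≡ b * (P * P)
  ring₂ = solve-∀
  xz≡ : x * z ≡ + p * (a * z)
  xz≡ = trans (cong (_* z) x≡ap) (ring₁ a (+ p) z)
  cases : + p ∣ℤ a ⊎ + p ∣ℤ z → + p * + p ∣ℤ x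
  cases (inj₁ (divides b a≡bp)) = divides b (trans x≡ap (trans (cong (_* + p) a≡bp) (ring₂ b (+ p))))
  cases (inj₂ p∣z) = ⊥-elim (p∤z p∣z)

-- For odd p the congruence V m ≡ ±2 even holds modulo p², since p² ∣ (V m - c)(V m + c)
-- and p cannot divide both factors (their difference is ±4).
V-≡±2-mod-p² : ∀ {p t m c} → Prime p → p ≢ 2 → + p ∣ℤ U t m → c ≡± + 2 → + p ∣ℤ V t m - c →
               + p * + p ∣ℤ V t m - c
V-≡±2-mod-p² {p} {t} {m} {c} pr p≢2 (divides q Um≡qp) c± p∣W-c =
  prime²-∣ (V t m - c) (V t m + c) pr p²∣product p∣W-c p∤W+c
  where
  W = V t m
  c²≡4 = proj₁ (≡±2-square c±)
  ring₁ : ∀ w c → (w - c) * (w + c) ≡ w * w - c * c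
  ring₁ = solve-∀
  ring₂ : ∀ D q P → D * (q * P * (q * P)) ≡ D * q * q * (P * P)
  ring₂ = solve-∀
  ring₃ : ∀ w c → w + c - (w - c) ≡ c + c
  ring₃ = solve-∀
  p²∣product : + p * + p ∣ℤ (W - c) * (W + c)
  p²∣product = divides ((t * t - + 4) * q * q) (begin
    (W - c) * (W + c)                   ≡⟨ ring₁ W c ⟩
    W * W - c * c                       ≡⟨ cong (λ z → W * W - z) c²≡4 ⟩
    W * W - + 4                         ≡⟨ V-square t m ⟩
    (t * t - + 4) * (U t m * U t m)     ≡⟨ cong (λ z → (t * t - + 4) * (z * z)) Um≡qp ⟩
    (t * t - + 4) * (q * + p * (q * + p)) ≡⟨ ring₂ (t * t - + 4) q (+ p) ⟩
    (t * t - + 4) * q * q * (+ p * + p) ∎)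
    where open ≡-Reasoning
  p∤W+c : ¬ + p ∣ℤ W + c
  p∤W+c p∣W+c = oddPrime∤4 pr p≢2
    (∣ℤ-≡± (proj₂ (≡±2-square c±)) (subst (+ p ∣ℤ_) (ring₃ W c) (∣m∣n⇒∣m-n p∣W+c p∣W-c)))

≡±-sign : ∀ {w n} → w ≡± + n → ∃[ σ ] σ ≡± + 1 × w ≡ σ * + n
≡±-sign {n = n} (inj₁ refl) = + 1 , inj₁ refl , sym (ℤP.*-identityˡ (+ n))
≡±-sign {n = n} (inj₂ refl) = - + 1 , inj₂ refl , sym (ℤP.-1*i≡-i (+ n))

exact-of-≡±p : ∀ {p x} σ → Prime p → σ ≡± + 1 → + p * + p ∣ℤ x - σ * + p →
               ∃[ y ] x ≡ + p * y × ¬ + p ∣ℤ y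
exact-of-≡±p {p} {x} σ pr σ± (divides e eq) = σ + e * + p , x≡ , p∤y
  where
  ring₁ : ∀ x s P → x ≡ (x - s * P) + s * P
  ring₁ = solve-∀
  ring₂ : ∀ s P e → e * (P * P) + s * P ≡ P * (s + e * P)
  ring₂ = solve-∀
  ring₃ : ∀ s P e → s + e * P - e * P ≡ s
  ring₃ = solve-∀
  x≡ : x ≡ + p * (σ + e * + p)
  x≡ = trans (ring₁ x σ (+ p)) (trans (cong (_+ σ * + p) eq) (ring₂ σ (+ p) e))
  p∤y : ¬ + p ∣ℤ σ + e * + p
  p∤y p∣y = prime∤1 pr (∣ℤ-≡± σ± (subst (+ p ∣ℤ_) (ring₃ σ (+ p) e)
                                  (∣m∣n⇒∣m-n p∣y (∣n⇒∣m*n e (ℤD.∣-refl {+ p})))))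

-- The two congruence facts behind the lifting-the-exponent lemma, for W = V m with p ∣ U m:
-- p ∣ U_W k only if p ∣ k, since U_W k ≡ U_{±2} k = ±k (mod p) ...
U-V-p∤ : ∀ {p t m k} → Prime p → + p ∣ℤ U t m → ¬ p ∣ k → ¬ + p ∣ℤ U (V t m) k
U-V-p∤ {p} {t} {m} {k} pr p∣Um p∤k p∣UWk = contradiction (V-≡±2 {t = t} {m = m} pr p∣Um)
  where
  ring : ∀ x y → x - (x - y) ≡ y
  ring = solve-∀
  contradiction : ∃[ c ] c ≡± + 2 × + p ∣ℤ V t m - c → ⊥
  contradiction (c , c± , p∣W-c) = p∤k (∣ℤ-≡± (U-±2 c± k)
    (subst (+ p ∣ℤ_) (ring (U (V t m) k) (U c k)) (∣m∣n⇒∣m-n p∣UWk (U-cong p∣W-c k))))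

-- ... and, p being odd, U_W p ≡ U_{±2} p = ±p (mod p²), so p exactly divides U_W p.
U-V-p : ∀ {p t m} → Prime p → p ≢ 2 → + p ∣ℤ U t m → ∃[ y ] U (V t m) p ≡ + p * y × ¬ + p ∣ℤ y
U-V-p {p} {t} {m} pr p≢2 p∣Um = exact (V-≡±2 {t = t} {m = m} pr p∣Um)
  where
  exact : ∃[ c ] c ≡± + 2 × + p ∣ℤ V t m - c → ∃[ y ] U (V t m) p ≡ + p * y × ¬ + p ∣ℤ y
  exact (c , c± , p∣W-c) =
    let (σ , σ± , Ucp≡σp) = ≡±-sign (U-±2 c± p) in
    exact-of-≡±p σ pr σ± (subst (λ z → + p * + p ∣ℤ U (V t m) p - z) Ucp≡σp
                                 (U-cong (V-≡±2-mod-p² {t = t} {m = m} pr p≢2 p∣Um c± p∣W-c) p))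

U-∣-mul : ∀ {M t} c m → M ∣ℤ U t m → M ∣ℤ U t (c ℕ.* m)
U-∣-mul {M} {t} c m M∣Um = subst (M ∣ℤ_) (sym (U-mul t c m)) (∣m⇒∣m*n (U (V t m) c) M∣Um)

-- By the multiplication formula it suffices to know ν_p (U_{V m} k), which is 0 for p ∤ k
-- and 1 for k = p; the general case follows by induction on k.
module LiftingTheExponent {p} (pr : Prime p) (p≢2 : p ≢ 2) {t} (nz : Nondegenerate t) where

  p≥2 : 2 ≤ p
  p≥2 = prime⇒2≤ pr

  p≥1 : 1 ≤ p
  p≥1 = ℕP.≤-trans (s≤s z≤n) p≥2

  ∣U-mul∣ : ∀ k m → ℤ.∣ U t (k ℕ.* m) ∣ ≡ ℤ.∣ U t m ∣ ℕ.* ℤ.∣ U (V t m) k ∣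
  ∣U-mul∣ k m = trans (cong ℤ.∣_∣ (U-mul t k m)) (ℤP.abs-* (U t m) (U (V t m) k))

  U-V-nonzero : ∀ k m → 1 ≤ k → 1 ≤ m → 1 ≤ ℤ.∣ U (V t m) k ∣
  U-V-nonzero k m k≥1 m≥1 =
    proj₂ (1≤*⁻ ℤ.∣ U t m ∣ ℤ.∣ U (V t m) k ∣ (subst (1 ≤_) (∣U-mul∣ k m) (nz (k ℕ.* m) (1≤* k≥1 m≥1))))

  vp-U-mul : ∀ k m → 1 ≤ k → 1 ≤ m →
             vpℕ p ℤ.∣ U t (k ℕ.* m) ∣ ≡ vpℕ p ℤ.∣ U t m ∣ ℕ.+ vpℕ p ℤ.∣ U (V t m) k ∣
  vp-U-mul k m k≥1 m≥1 = trans (cong (vpℕ p) (∣U-mul∣ k m)) (vp-* pr (nz m m≥1) (U-V-nonzero k m k≥1 m≥1))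

  lte-coprime : ∀ k m → 1 ≤ k → 1 ≤ m → + p ∣ℤ U t m → ¬ p ∣ k →
                vpℕ p ℤ.∣ U t (k ℕ.* m) ∣ ≡ vpℕ p ℤ.∣ U t m ∣ ℕ.+ vpℕ p k
  lte-coprime k m k≥1 m≥1 p∣Um p∤k = trans (vp-U-mul k m k≥1 m≥1) (cong (vpℕ p ℤ.∣ U t m ∣ ℕ.+_)
    (trans (vp-coprime p≥2 (U-V-nonzero k m k≥1 m≥1) (λ h → U-V-p∤ {t = t} {m = m} pr p∣Um p∤k (∣ᵤ⇒∣ h)))
           (sym (vp-coprime p≥2 k≥1 p∤k))))

  lte-p : ∀ m → 1 ≤ m → + p ∣ℤ U t m → vpℕ p ℤ.∣ U t (p ℕ.* m) ∣ ≡ vpℕ p ℤ.∣ U t m ∣ ℕ.+ 1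
  lte-p m m≥1 p∣Um = trans (vp-U-mul p m p≥1 m≥1)
    (cong (vpℕ p ℤ.∣ U t m ∣ ℕ.+_) (vp-UWp≡1 (U-V-p {t = t} {m = m} pr p≢2 p∣Um)))
    where
    open ≡-Reasoning
    vp-UWp≡1 : ∃[ y ] U (V t m) p ≡ + p * y × ¬ + p ∣ℤ y → vpℕ p ℤ.∣ U (V t m) p ∣ ≡ 1
    vp-UWp≡1 (y , UWp≡py , p∤y) = begin
      vpℕ p ℤ.∣ U (V t m) p ∣         ≡⟨ cong (vpℕ p) ∣UWp∣≡ ⟩
      vpℕ p (p ℕ.* ℤ.∣ y ∣)           ≡⟨ vp-* pr p≥1 y≥1 ⟩
      vpℕ p p ℕ.+ vpℕ p ℤ.∣ y ∣
        ≡⟨ cong₂ ℕ._+_ (vp-self p≥2) (vp-coprime p≥2 y≥1 (λ h → p∤y (∣ᵤ⇒∣ h))) ⟩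
      1 ∎
      where
      ∣UWp∣≡ : ℤ.∣ U (V t m) p ∣ ≡ p ℕ.* ℤ.∣ y ∣
      ∣UWp∣≡ = trans (cong ℤ.∣_∣ UWp≡py) (ℤP.abs-* (+ p) y)
      y≥1 : 1 ≤ ℤ.∣ y ∣
      y≥1 = proj₂ (1≤*⁻ p ℤ.∣ y ∣ (subst (1 ≤_) ∣UWp∣≡ (U-V-nonzero p m p≥1 m≥1)))

  lte : ∀ k m → 1 ≤ k → 1 ≤ m → + p ∣ℤ U t m →
        vpℕ p ℤ.∣ U t (k ℕ.* m) ∣ ≡ vpℕ p ℤ.∣ U t m ∣ ℕ.+ vpℕ p k
  lte = <-rec _ step
    where
    -- for k = k' p, apply the induction hypothesis to k' and p m
    step : ∀ k → (∀ {k'} → k' < k → ∀ m → 1 ≤ k' → 1 ≤ m → + p ∣ℤ U t m →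
                  vpℕ p ℤ.∣ U t (k' ℕ.* m) ∣ ≡ vpℕ p ℤ.∣ U t m ∣ ℕ.+ vpℕ p k') →
           ∀ m → 1 ≤ k → 1 ≤ m → + p ∣ℤ U t m →
           vpℕ p ℤ.∣ U t (k ℕ.* m) ∣ ≡ vpℕ p ℤ.∣ U t m ∣ ℕ.+ vpℕ p k
    step k IH m k≥1 m≥1 p∣Um with p ℕD.∣? k
    ... | no p∤k = lte-coprime k m k≥1 m≥1 p∣Um p∤k
    ... | yes (ℕD.divides k' k≡k'p) = begin
        vpℕ p ℤ.∣ U t (k ℕ.* m) ∣               ≡⟨ cong (λ z → vpℕ p ℤ.∣ U t z ∣) km≡ ⟩
        vpℕ p ℤ.∣ U t (k' ℕ.* (p ℕ.* m)) ∣      ≡⟨ IH k'<k (p ℕ.* m) k'≥1 (1≤* p≥1 m≥1) (U-∣-mul p m p∣Um) ⟩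
        vpℕ p ℤ.∣ U t (p ℕ.* m) ∣ ℕ.+ vpℕ p k'  ≡⟨ cong (ℕ._+ vpℕ p k') (lte-p m m≥1 p∣Um) ⟩
        vpℕ p ℤ.∣ U t m ∣ ℕ.+ 1 ℕ.+ vpℕ p k'    ≡⟨ ℕP.+-assoc (vpℕ p ℤ.∣ U t m ∣) 1 (vpℕ p k') ⟩
        vpℕ p ℤ.∣ U t m ∣ ℕ.+ (1 ℕ.+ vpℕ p k')  ≡⟨ cong (vpℕ p ℤ.∣ U t m ∣ ℕ.+_) (ℕP.+-comm 1 (vpℕ p k')) ⟩
        vpℕ p ℤ.∣ U t m ∣ ℕ.+ (vpℕ p k' ℕ.+ 1)  ≡⟨ cong (vpℕ p ℤ.∣ U t m ∣ ℕ.+_) vp-k ⟩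
        vpℕ p ℤ.∣ U t m ∣ ℕ.+ vpℕ p k ∎
      where
      open ≡-Reasoning
      km≡ : k ℕ.* m ≡ k' ℕ.* (p ℕ.* m)
      km≡ = trans (cong (ℕ._* m) k≡k'p) (ℕP.*-assoc k' p m)
      k'≥1 : 1 ≤ k'
      k'≥1 = proj₁ (1≤*⁻ k' p (subst (1 ≤_) k≡k'p k≥1))
      k'<k : k' < k
      k'<k = subst (k' <_) (sym k≡k'p) (ℕP.m<m*n k' p {{ℕ.>-nonZero k'≥1}} p≥2)
      vp-k : vpℕ p k' ℕ.+ 1 ≡ vpℕ p k
      vp-k = sym (trans (cong (vpℕ p) k≡k'p)
                        (trans (vp-* pr k'≥1 p≥1) (cong (vpℕ p k' ℕ.+_) (vp-self p≥2))))

prime-coprime : ∀ {p n} → Prime p → ¬ p ∣ n → Coprime p n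
prime-coprime pr p∤n {d} (d∣p , d∣n) with prime⇒irreducible pr d∣p
... | inj₁ d≡1 = d≡1
... | inj₂ refl = ⊥-elim (p∤n d∣n)

inverse-ℕ : ∀ {p} n → Prime p → ¬ p ∣ n → ∃[ w ] + p ∣ℤ + n * w - + 1
inverse-ℕ {p} n pr p∤n with coprime-Bézout (prime-coprime pr p∤n)
... | Bézout.+- x y eq = - + y , divides (- + x) (begin
    + n * - + y - + 1        ≡⟨ ring₁ (+ n) (+ y) ⟩
    - (+ 1 + + y * + n)
      ≡⟨ cong -_ (trans (cong (λ z → + 1 + z) (sym (ℤP.pos-* y n)))
                        (trans (cong +_ eq) (ℤP.pos-* x p))) ⟩
    - (+ x * + p)            ≡⟨ ring₂ (+ x) (+ p) ⟩
    - + x * + p ∎)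
  where
  open ≡-Reasoning
  ring₁ : ∀ n y → n * - y - + 1 ≡ - (+ 1 + y * n)
  ring₁ = solve-∀
  ring₂ : ∀ x p → - (x * p) ≡ - x * p
  ring₂ = solve-∀
... | Bézout.-+ x y eq = + y , divides (+ x) (begin
    + n * + y - + 1          ≡⟨ ring₁ (+ n) (+ y) ⟩
    + y * + n - + 1
      ≡⟨ cong (_- + 1) (sym (trans (cong (λ z → + 1 + z) (sym (ℤP.pos-* x p)))
                                   (trans (cong +_ eq) (ℤP.pos-* y n)))) ⟩
    + 1 + + x * + p - + 1    ≡⟨ ring₂ (+ x) (+ p) ⟩
    + x * + p ∎)
  where
  open ≡-Reasoning
  ring₁ : ∀ n y → n * y - + 1 ≡ y * n - + 1
  ring₁ = solve-∀
  ring₂ : ∀ x p → + 1 + x * p - + 1 ≡ x * p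
  ring₂ = solve-∀

inverse : ∀ {p} y → Prime p → ¬ + p ∣ℤ y → ∃[ w ] + p ∣ℤ y * w - + 1
inverse {p} (+ n) pr p∤y = inverse-ℕ n pr (λ h → p∤y (∣ᵤ⇒∣ h))
inverse {p} ℤ.-[1+ n ] pr p∤y with inverse-ℕ (suc n) pr (λ h → p∤y (∣ᵤ⇒∣ h))
... | w , h = - w , subst (+ p ∣ℤ_) (ring (+ suc n) w) h
  where ring : ∀ n w → n * w - + 1 ≡ - n * - w - + 1
        ring = solve-∀

∣ℤ-resp-≡± : ∀ {M x y} → x ≡± y → M ∣ℤ x → M ∣ℤ y
∣ℤ-resp-≡± (inj₁ refl) h = h
∣ℤ-resp-≡± {y = y} (inj₂ refl) h = subst (_ ∣ℤ_) (ℤP.neg-involutive y) (∣m⇒∣-m h)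

-- Rank of apparition: an odd prime p = 2k+1 divides some U n with 1 ≤ n ≤ p.
-- The p+1 points  (U ℓ, U (ℓ+1))  and  (U (ℓ+1), U ℓ)  (ℓ ≤ k) are sent to Fin p by the
-- "slope" x/y mod p, where y ≡ 0 is sent to the same value as slope 1.  By pigeonhole two
-- points collide, and every kind of collision yields a suitable n through the addition
-- formulas: equal slopes give p ∣ x y' - y x' = ±U n, slope 1 gives p ∣ U ℓ+1 - U ℓ ∣ U (2ℓ+1).
module Apparition (t : ℤ) {p k : ℕ} (pr : Prime p) (p≡2k+1 : p ≡ suc (k ℕ.+ k)) where

  instance
    p≢0 : ℕ.NonZero p
    p≢0 = prime⇒nonZero pr

  Found : Set
  Found = ∃[ n ] 1 ≤ n × n ≤ p × + p ∣ℤ U t n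

  found : ∀ n → 1 ≤ n → n ≤ p → ∀ {z} → z ≡± U t n → + p ∣ℤ z → Found
  found n n≥1 n≤p z± p∣z = n , n≥1 , n≤p , ∣ℤ-resp-≡± z± p∣z

  slope : ∀ x y → ¬ + p ∣ℤ y → ∃[ c ] + p ∣ℤ x - + Fin.toℕ {p} c * y
  slope x y p∤y = c , subst (+ p ∣ℤ_) eq (∣m∣n⇒∣m+n (∣n⇒∣m*n (- x) (proj₂ w)) (∣m⇒∣m*n y r∣))
    where
    w = inverse y pr p∤y
    xw = x * proj₁ w
    c : Fin p
    c = Fin.fromℕ< (n%ℕd<d xw p)
    r∣ : + p ∣ℤ xw - + (xw %ℕ p)
    r∣ = divides (xw /ℕ p) (trans (cong (_- + (xw %ℕ p)) (a≡a%ℕn+[a/ℕn]*n xw p)) (ring (+ (xw %ℕ p)) _))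
      where ring : ∀ a b → a + b - a ≡ b
            ring = solve-∀
    ring : ∀ x y w c → - x * (y * w - + 1) + (x * w - c) * y ≡ x - c * y
    ring = solve-∀
    eq : - x * (y * proj₁ w - + 1) + (xw - + (xw %ℕ p)) * y ≡ x - + Fin.toℕ c * y
    eq = trans (ring x y (proj₁ w) (+ (xw %ℕ p)))
               (cong (λ z → x - + z * y) (sym (FinP.toℕ-fromℕ< (n%ℕd<d xw p))))

  one : Fin p
  one = Fin.fromℕ< {1} (prime⇒2≤ pr)

  slopeKey : ∀ x y → Dec (+ p ∣ℤ y) → Fin p
  slopeKey x y (yes _) = one
  slopeKey x y (no p∤y) = proj₁ (slope x y p∤y)

  key : ℤ × ℤ → Fin p
  key (x , y) = slopeKey x y (+ p ℤD.∣? y)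

  Proportional : ℤ × ℤ → ℤ × ℤ → Set
  Proportional (x , y) (x' , y') = + p ∣ℤ x * y' - y * x'

  Diagonal : ℤ × ℤ → Set
  Diagonal (x , y) = + p ∣ℤ x - y

  slope-one : ∀ x y → + p ∣ℤ x - + Fin.toℕ one * y → Diagonal (x , y)
  slope-one x y = subst (+ p ∣ℤ_) (trans (cong (λ z → x - + z * y) (FinP.toℕ-fromℕ< (prime⇒2≤ pr))) (ring x y))
    where ring : ∀ x y → x - + 1 * y ≡ x - y
          ring = solve-∀

  slopeKey-collision : ∀ x y x' y' d d' → slopeKey x y d ≡ slopeKey x' y' d' →
                       Proportional (x , y) (x' , y') ⊎ Diagonal (x , y) ⊎ Diagonal (x' , y')
  slopeKey-collision x y x' y' (yes p∣y) (yes p∣y') _ =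
    inj₁ (∣m∣n⇒∣m-n (∣n⇒∣m*n x p∣y') (∣m⇒∣m*n x' p∣y))
  slopeKey-collision x y x' y' (yes _) (no p∤y') one≡c' =
    inj₂ (inj₂ (slope-one x' y'
      (subst (λ c → + p ∣ℤ x' - + Fin.toℕ c * y') (sym one≡c') (proj₂ (slope x' y' p∤y')))))
  slopeKey-collision x y x' y' (no p∤y) (yes _) c≡one =
    inj₂ (inj₁ (slope-one x y (subst (λ c → + p ∣ℤ x - + Fin.toℕ c * y) c≡one (proj₂ (slope x y p∤y)))))
  slopeKey-collision x y x' y' (no p∤y) (no p∤y') c≡c' =
    inj₁ (subst (+ p ∣ℤ_) (ring x y x' y' (+ Fin.toℕ c))
      (∣m∣n⇒∣m-n (∣m⇒∣m*n y' (proj₂ (slope x y p∤y)))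
                 (∣m⇒∣m*n y (subst (λ c → + p ∣ℤ x' - + Fin.toℕ c * y') (sym c≡c')
                                   (proj₂ (slope x' y' p∤y'))))))
    where
    c = proj₁ (slope x y p∤y)
    ring : ∀ x y x' y' c → (x - c * y) * y' - (x' - c * y') * y ≡ x * y' - y * x'
    ring = solve-∀

  key-collision : ∀ a b → key a ≡ key b → Proportional a b ⊎ Diagonal a ⊎ Diagonal b
  key-collision (x , y) (x' , y') = slopeKey-collision x y x' y' (+ p ℤD.∣? y) (+ p ℤD.∣? y')

  m : ℕ
  m = suc k

  pointBy : (ℓ : ℕ) → Dec (ℓ < m) → ℤ × ℤ
  pointBy ℓ (yes _) = U t ℓ , U t (suc ℓ)
  pointBy ℓ (no _) = U t (suc (ℓ ∸ m)) , U t (ℓ ∸ m)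

  point : ℕ → ℤ × ℤ
  point ℓ = pointBy ℓ (ℓ ℕ.<? m)

  ≤k⇒≤p : ∀ {a} → a ≤ k → a ≤ p
  ≤k⇒≤p a≤k = subst (_ ≤_) (sym p≡2k+1) (ℕP.≤-trans a≤k (ℕP.≤-trans (ℕP.m≤m+n _ _) (ℕP.n≤1+n _)))

  sum≤p : ∀ {a b} → a ≤ k → b ≤ k → suc (a ℕ.+ b) ≤ p
  sum≤p a≤k b≤k = subst (_ ≤_) (sym p≡2k+1) (s≤s (ℕP.+-mono-≤ a≤k b≤k))

  mirror< : ∀ ℓ → ¬ ℓ < m → ℓ < m ℕ.+ m → ℓ ∸ m < m
  mirror< ℓ ℓ≮m ℓ<2m = ℕP.+-cancelˡ-< m (ℓ ∸ m) m
    (subst (_< m ℕ.+ m) (sym (ℕP.m+[n∸m]≡n (ℕP.≮⇒≥ ℓ≮m))) ℓ<2m)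

  -- p ∣ U (j+1) - U j forces p ∣ U (2j+1) = (U (j+1) - U j)(U (j+1) + U j).
  odd-index : ∀ j → j ≤ k → + p ∣ℤ U t (suc j) - U t j → Found
  odd-index j j≤k h = found (suc (j ℕ.+ j)) (s≤s z≤n) (sum≤p j≤k j≤k)
    (inj₁ (sym (trans (U-add t j j) (ring (U t (suc j)) (U t j))))) (∣m⇒∣m*n (U t (suc j) + U t j) h)
    where ring : ∀ x y → x * x - y * y ≡ (x - y) * (x + y)
          ring = solve-∀

  diagonal⇒found : ∀ ℓ d → ℓ < m ℕ.+ m → Diagonal (pointBy ℓ d) → Found
  diagonal⇒found ℓ (yes ℓ<m) _ h =
    odd-index ℓ (ℕP.≤-pred ℓ<m) (subst (+ p ∣ℤ_) (ring (U t ℓ) (U t (suc ℓ))) (∣m⇒∣-m h))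
    where ring : ∀ a b → - (a - b) ≡ b - a
          ring = solve-∀
  diagonal⇒found ℓ (no ℓ≮m) ℓ<2m h = odd-index (ℓ ∸ m) (ℕP.≤-pred (mirror< ℓ ℓ≮m ℓ<2m)) h

  gap-found : ∀ i j → i < j → j ≤ k → ∀ {z} → z ≡± U t (suc i) * U t j - U t i * U t (suc j) →
              + p ∣ℤ z → Found
  gap-found i j i<j j≤k (inj₁ refl) = found (j ∸ i) (ℕP.m<n⇒0<n∸m i<j)
    (≤k⇒≤p (ℕP.≤-trans (ℕP.m∸n≤m j i) j≤k)) (inj₁ (U-gap t i j (ℕP.<⇒≤ i<j)))
  gap-found i j i<j j≤k (inj₂ refl) = found (j ∸ i) (ℕP.m<n⇒0<n∸m i<j)
    (≤k⇒≤p (ℕP.≤-trans (ℕP.m∸n≤m j i) j≤k)) (inj₂ (cong -_ (U-gap t i j (ℕP.<⇒≤ i<j))))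

  proportional⇒found : ∀ i j di dj → i < j → j < m ℕ.+ m →
                       Proportional (pointBy i di) (pointBy j dj) → Found
  proportional⇒found i j (yes i<m) (yes j<m) i<j _ =
    gap-found i j i<j (ℕP.≤-pred j<m) (inj₂ (ring (U t i) (U t (suc j)) (U t (suc i)) (U t j)))
    where ring : ∀ a b c d → a * b - c * d ≡ - (c * d - a * b)
          ring = solve-∀
  proportional⇒found i j (yes i<m) (no j≮m) _ j<2m =
    found (suc (i ℕ.+ j')) (s≤s z≤n) (sum≤p (ℕP.≤-pred i<m) (ℕP.≤-pred (mirror< j j≮m j<2m)))
      (inj₂ (trans (ring (U t i) (U t j') (U t (suc i)) (U t (suc j'))) (cong -_ (sym (U-add t i j')))))
    where
    j' = j ∸ m
    ring : ∀ a b c d → a * b - c * d ≡ - (c * d - a * b)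
    ring = solve-∀
  proportional⇒found i j (no i≮m) (yes j<m) i<j _ = ⊥-elim (i≮m (ℕP.<-trans i<j j<m))
  proportional⇒found i j (no i≮m) (no j≮m) i<j j<2m =
    gap-found (i ∸ m) (j ∸ m) (ℕP.∸-monoˡ-< i<j (ℕP.≮⇒≥ i≮m)) (ℕP.≤-pred (mirror< j j≮m j<2m)) (inj₁ refl)

  index< : (ℓ : Fin (suc p)) → Fin.toℕ ℓ < m ℕ.+ m
  index< ℓ = subst (Fin.toℕ ℓ <_) p+1≡2m (FinP.toℕ<n ℓ)
    where p+1≡2m = trans (cong suc p≡2k+1) (cong suc (sym (ℕP.+-suc k k)))

  collision⇒found : (i j : Fin (suc p)) → Fin.toℕ i < Fin.toℕ j →
                    Proportional (point (Fin.toℕ i)) (point (Fin.toℕ j)) ⊎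
                    Diagonal (point (Fin.toℕ i)) ⊎ Diagonal (point (Fin.toℕ j)) → Found
  collision⇒found i j i<j (inj₁ prop) =
    proportional⇒found (Fin.toℕ i) (Fin.toℕ j) (Fin.toℕ i ℕ.<? m) (Fin.toℕ j ℕ.<? m) i<j (index< j) prop
  collision⇒found i j i<j (inj₂ (inj₁ diag)) = diagonal⇒found (Fin.toℕ i) (Fin.toℕ i ℕ.<? m) (index< i) diag
  collision⇒found i j i<j (inj₂ (inj₂ diag)) = diagonal⇒found (Fin.toℕ j) (Fin.toℕ j ℕ.<? m) (index< j) diag

  rank : Found
  rank = let (i , j , i<j , same) = FinP.pigeonhole (ℕP.n<1+n p) (λ ℓ → key (point (Fin.toℕ ℓ)))
         in collision⇒found i j i<j (key-collision (point (Fin.toℕ i)) (point (Fin.toℕ j)) same)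

-- ν_p (i / n) = ν_p i - ν_p n: cancelling the gcd changes both valuations by the same amount.
vpℚ-/ : ∀ {p} i n .{{_ : ℕ.NonZero n}} → Prime p → 1 ≤ ℤ.∣ i ∣ →
        vpℚ p (i ℚ./ n) ≡ + vpℕ p ℤ.∣ i ∣ - + vpℕ p n
vpℚ-/ {p} i n pr i≠0 = begin
    + a - + b                         ≡⟨ ring (+ a) (+ b) (+ c) ⟩
    + (a ℕ.+ c) - + (b ℕ.+ c)         ≡⟨ cong₂ (λ x y → + x - + y) (sym vp-i) (sym vp-n) ⟩
    + vpℕ p ℤ.∣ i ∣ - + vpℕ p n ∎
  where
  open ≡-Reasoning
  q = i ℚ./ n
  g = ℤ.∣ ℤGCD.gcd i (+ n) ∣
  num·g : ℤ.∣ ℚ.↥ q ∣ ℕ.* g ≡ ℤ.∣ i ∣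
  num·g = trans (sym (ℤP.abs-* (ℚ.↥ q) (ℤGCD.gcd i (+ n)))) (cong ℤ.∣_∣ (ℚP.↥-/ i n))
  den·g : ℚ.↧ₙ q ℕ.* g ≡ n
  den·g = trans (sym (ℤP.abs-* (ℚ.↧ q) (ℤGCD.gcd i (+ n)))) (cong ℤ.∣_∣ (ℚP.↧-/ i n))
  a = vpℕ p ℤ.∣ ℚ.↥ q ∣
  b = vpℕ p (ℚ.↧ₙ q)
  c = vpℕ p g
  vp-i : vpℕ p ℤ.∣ i ∣ ≡ a ℕ.+ c
  vp-i = let (h₁ , h₂) = 1≤*⁻ _ g (subst (1 ≤_) (sym num·g) i≠0) in
         trans (cong (vpℕ p) (sym num·g)) (vp-* pr h₁ h₂)
  vp-n : vpℕ p n ≡ b ℕ.+ c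
  vp-n = let (h₁ , h₂) = 1≤*⁻ _ g (subst (1 ≤_) (sym den·g) (ℕ.>-nonZero⁻¹ n)) in
         trans (cong (vpℕ p) (sym den·g)) (vp-* pr h₁ h₂)
  ring : ∀ a b c → a - b ≡ (a + c) - (b + c)
  ring = solve-∀

foldr-⊓-≤ : ∀ {x xs y} → y ∈ x ∷ xs → foldr ℤ._⊓_ x xs ℤ.≤ y
foldr-⊓-≤ {xs = []} (here refl) = ℤP.≤-refl
foldr-⊓-≤ {x} {z ∷ zs} (here refl) = ℤP.≤-trans (ℤP.i⊓j≤j z _) (foldr-⊓-≤ {x} {zs} (here refl))
foldr-⊓-≤ {x} {z ∷ zs} (there (here refl)) = ℤP.i⊓j≤i z (foldr ℤ._⊓_ x zs)
foldr-⊓-≤ {x} {z ∷ zs} (there (there y∈)) = ℤP.≤-trans (ℤP.i⊓j≤j z _) (foldr-⊓-≤ {x} {zs} (there y∈))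

foldr-⊓-glb : ∀ {b x xs} → All (b ℤ.≤_) (x ∷ xs) → b ℤ.≤ foldr ℤ._⊓_ x xs
foldr-⊓-glb {xs = []} (b≤x ∷ []) = b≤x
foldr-⊓-glb {xs = z ∷ zs} (b≤x ∷ b≤z ∷ b≤zs) = ℤP.⊓-glb b≤z (foldr-⊓-glb (b≤x ∷ b≤zs))

minList-attained : ∀ {b} xs → All (b ℤ.≤_) xs → b ∈ xs → minList xs ≡ b
minList-attained (x ∷ xs) b≤xs b∈xs = ℤP.≤-antisym (foldr-⊓-≤ b∈xs) (foldr-⊓-glb b≤xs)

halve : ∀ n → (∃[ k ] n ≡ k ℕ.+ k) ⊎ (∃[ k ] n ≡ suc (k ℕ.+ k))
halve zero = inj₁ (0 , refl)
halve (suc n) with halve n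
... | inj₁ (k , n≡2k) = inj₂ (k , cong suc n≡2k)
... | inj₂ (k , n≡2k+1) = inj₁ (suc k , cong suc (trans n≡2k+1 (sym (ℕP.+-suc k k))))

odd-prime-form : ∀ {p} → Prime p → p ≢ 2 → ∃[ k ] p ≡ suc (k ℕ.+ k)
odd-prime-form {p} pr p≢2 with halve p
... | inj₂ odd = odd
... | inj₁ (k , p≡2k) with prime⇒irreducible pr (ℕD.divides k (trans p≡2k k+k≡k*2))
  where k+k≡k*2 = trans (cong (k ℕ.+_) (sym (ℕP.+-identityʳ k))) (ℕP.*-comm 2 k)
...   | inj₁ ()
...   | inj₂ 2≡p = ⊥-elim (p≢2 (sym 2≡p))

odd-divisor≢2 : ∀ {p n} → p ∣ n → ¬ 2 ∣ n → p ≢ 2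
odd-divisor≢2 p∣n n-odd refl = n-odd p∣n

prime-factor-split : ∀ {p q M} → Prime p → Prime q → q ∣ p ℕ.* M → q ≡ p ⊎ q ∣ M
prime-factor-split {p} {q} {M} p-prime q-prime q∣pM with euclidsLemma p M q-prime q∣pM
... | inj₂ q∣M = inj₂ q∣M
... | inj₁ q∣p with prime⇒irreducible p-prime q∣p
...   | inj₁ refl = ⊥-elim (prime∤1 q-prime ℕD.∣-refl)
...   | inj₂ q≡p = inj₁ q≡p

CommonIndex : ℤ → ℕ → ℕ → Set
CommonIndex t M N = ∀ {q} → Prime q → q ∣ M → + q ∣ℤ U t N

-- For a list of odd primes, the product N of their ranks of apparition is a common index
-- for their product, with 1 ≤ N ≤ ∏ as.
common-index : ∀ t as → All Prime as → ¬ 2 ∣ product as →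
               ∃[ N ] 1 ≤ N × N ≤ product as × CommonIndex t (product as) N
common-index t [] [] _ = 1 , s≤s z≤n , ℕP.≤-refl , λ q-prime q∣1 → ⊥-elim (prime∤1 q-prime q∣1)
common-index t (p ∷ as) (p-prime ∷ as-prime) odd =
  extend (Apparition.rank t {k = proj₁ p-form} p-prime (proj₂ p-form)) (common-index t as as-prime as-odd)
  where
  p-form = odd-prime-form p-prime (odd-divisor≢2 (ℕD.∣m⇒∣m*n (product as) ℕD.∣-refl) odd)
  as-odd : ¬ 2 ∣ product as
  as-odd 2∣as = odd (ℕD.∣n⇒∣m*n p 2∣as)
  extend : (∃[ n ] 1 ≤ n × n ≤ p × + p ∣ℤ U t n) →
           (∃[ N ] 1 ≤ N × N ≤ product as × CommonIndex t (product as) N) →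
           ∃[ N ] 1 ≤ N × N ≤ p ℕ.* product as × CommonIndex t (p ℕ.* product as) N
  extend (n , n≥1 , n≤p , p∣Un) (N , N≥1 , N≤∏as , N-common) =
    N ℕ.* n , 1≤* N≥1 n≥1 , subst (N ℕ.* n ≤_) (ℕP.*-comm (product as) p) (ℕP.*-mono-≤ N≤∏as n≤p) ,
    λ q-prime q∣ → common q-prime (prime-factor-split p-prime q-prime q∣)
    where
    common : ∀ {q} → Prime q → q ≡ p ⊎ q ∣ product as → + q ∣ℤ U t (N ℕ.* n)
    common q-prime (inj₁ refl) = U-∣-mul N n p∣Un
    common {q} q-prime (inj₂ q∣as) =
      subst (λ z → + q ∣ℤ U t z) (ℕP.*-comm n N) (U-∣-mul n N (N-common q-prime q∣as))

least-below : ∀ (Q : ℕ → Set) → (∀ n → Dec (Q n)) → ∀ b →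
              (∀ j → j < b → ¬ Q j) ⊎ (∃[ m ] m < b × Q m × (∀ j → j < m → ¬ Q j))
least-below Q Q? zero = inj₁ (λ j ())
least-below Q Q? (suc b) with least-below Q Q? b
... | inj₂ (m , m<b , Qm , below-m) = inj₂ (m , ℕP.m<n⇒m<1+n m<b , Qm , below-m)
... | inj₁ below-b with Q? b
...   | yes Qb = inj₂ (b , ℕP.n<1+n b , Qb , below-b)
...   | no ¬Qb = inj₁ below-b+1
  where
  below-b+1 : ∀ j → j < suc b → ¬ Q j
  below-b+1 j j<b+1 with ℕP.m≤n⇒m<n∨m≡n (ℕP.≤-pred j<b+1)
  ... | inj₁ j<b = below-b j j<b
  ... | inj₂ refl = ¬Qb

-- A decidable set of naturals closed under multiples and differences, with a positive
-- element N, has a least positive element d' ≤ N, and it consists of the multiples of d'.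
module LeastElement (M : ℕ → Set) (M? : ∀ n → Dec (M n))
                    (M-mul : ∀ c n → M n → M (c ℕ.* n))
                    (M-∸ : ∀ n j → M n → M j → j ≤ n → M (n ∸ j))
                    {N : ℕ} (N≥1 : 1 ≤ N) (MN : M N) where

  Positive : ℕ → Set
  Positive n = 1 ≤ n × M n

  minimal : ∃[ m ] m < suc N × Positive m × (∀ j → j < m → ¬ Positive j)
  minimal with least-below Positive (λ n → (1 ℕ.≤? n) ×-dec M? n) (suc N)
  ... | inj₂ found = found
  ... | inj₁ none = ⊥-elim (none N (ℕP.n<1+n N) (N≥1 , MN))

  d' : ℕ
  d' = proj₁ minimal

  d'≥1 : 1 ≤ d'
  d'≥1 = proj₁ (proj₁ (proj₂ (proj₂ minimal)))

  d'≤N : d' ≤ N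
  d'≤N = ℕP.≤-pred (proj₁ (proj₂ minimal))

  instance
    d'≢0 : ℕ.NonZero d'
    d'≢0 = ℕ.>-nonZero d'≥1

  Md' : M d'
  Md' = proj₂ (proj₁ (proj₂ (proj₂ minimal)))

  -- the remainder n mod d' lies in M and is below d', hence is 0
  M⇒∣ : ∀ n → M n → d' ∣ n
  M⇒∣ n Mn with n % d' in n%d'≡r
  ... | zero = ℕD.m%n≡0⇒n∣m n d' n%d'≡r
  ... | suc r = ⊥-elim (proj₂ (proj₂ (proj₂ minimal)) (suc r) r<d' (s≤s z≤n , Mr))
    where
    n≡ : n ≡ suc r ℕ.+ (n / d') ℕ.* d'
    n≡ = trans (m≡m%n+[m/n]*n n d') (cong (ℕ._+ (n / d') ℕ.* d') n%d'≡r)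
    r<d' : suc r < d'
    r<d' = subst (_< d') n%d'≡r (m%n<n n d')
    Mr : M (suc r)
    Mr = subst M (trans (cong (_∸ (n / d') ℕ.* d') n≡) (ℕP.m+n∸n≡m (suc r) ((n / d') ℕ.* d')))
               (M-∸ n ((n / d') ℕ.* d') Mn (M-mul (n / d') d' Md') (m/n*n≤m n d'))

floorDiv-nonneg : ∀ x a → + 0 ℤ.≤ floorDiv (+ x) a
floorDiv-nonneg x zero = ℤP.≤-refl
floorDiv-nonneg x (suc a) = ℤ.+≤+ z≤n

floorDiv-zero : ∀ a → floorDiv (+ 0) a ≡ + 0
floorDiv-zero zero = refl
floorDiv-zero (suc a) = refl

δ-yes : ∀ {d' n} → d' ∣ n → δ d' n ≡ + 1
δ-yes {d'} {n} h = cong (λ b → if b then + 1 else + 0) (dec-true (d' ℕD.∣? n) h)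

δ-no : ∀ {d' n} → ¬ d' ∣ n → δ d' n ≡ + 0
δ-no {d'} {n} h = cong (λ b → if b then + 1 else + 0) (dec-false (d' ℕD.∣? n) h)

module Main (t : ℤ) (nz : Nondegenerate t) (d : ℕ) (d≥1 : 1 ≤ d) (d-odd : ¬ 2 ∣ d) where

  P : List ℕ
  P = primeDivisors d

  ∈P : ∀ {p} → p ∈ P → Prime p × p ∣ d
  ∈P p∈P = proj₂ (∈-filter⁻ (λ p → prime? p ×-dec (p ℕD.∣? d)) {xs = upTo (suc d)} p∈P)

  M : ℕ → Set
  M n = All (λ p → + p ∣ℤ U t n) P

  M-mul : ∀ c n → M n → M (c ℕ.* n)
  M-mul c n = All.map (U-∣-mul c n)

  M-∸ : ∀ n j → M n → M j → j ≤ n → M (n ∸ j)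
  M-∸ n j Mn Mj j≤n = All.zipWith (λ (p∣Un , p∣Uj) → subst (_ ∣ℤ_) (U-gap t j n j≤n)
      (∣m∣n⇒∣m-n (∣n⇒∣m*n (U t (suc j)) p∣Un) (∣m⇒∣m*n (U t (suc n)) p∣Uj))) (Mn , Mj)

  witness : ∃[ N ] 1 ≤ N × N ≤ d × M N
  witness =
    let instance _ = ℕ.>-nonZero d≥1
        fac = factorise d
        d≡∏ = PrimeFactorisation.isFactorisation fac
        (N , N≥1 , N≤∏ , common) = common-index t (PrimeFactorisation.factors fac)
          (PrimeFactorisation.factorsPrime fac) (λ h → d-odd (subst (2 ∣_) (sym d≡∏) h))
    in N , N≥1 , subst (N ≤_) (sym d≡∏) N≤∏ ,
       All.tabulate (λ p∈P → common (proj₁ (∈P p∈P)) (subst (_ ∣_) d≡∏ (proj₂ (∈P p∈P))))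

  open LeastElement M (λ n → All.all? (λ p → + p ℤD.∣? U t n) P) M-mul M-∸
                    (proj₁ (proj₂ witness)) (proj₂ (proj₂ (proj₂ witness))) public

  d'≤d : d' ≤ d
  d'≤d = ℕP.≤-trans d'≤N (proj₁ (proj₂ (proj₂ witness)))

  s' : ℤ
  s' = U t d'

  s'≢0 : s' ≢ + 0
  s'≢0 s'≡0 = ℕP.<⇒≱ (nz d' d'≥1) (ℕP.≤-reflexive (cong ℤ.∣_∣ s'≡0))

  vpℚ-U : ∀ {p} n → 1 ≤ n → Prime p → vpℚ p (U t n ℚ./ 1) ≡ + vpℕ p ℤ.∣ U t n ∣
  vpℚ-U {p} n n≥1 pr = trans (vpℚ-/ (U t n) 1 pr (nz n n≥1))
    (trans (cong (λ z → + vpℕ p ℤ.∣ U t n ∣ - + z) (vp-coprime (prime⇒2≤ pr) ℕP.≤-refl (prime∤1 pr)))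
           (ℤP.+-identityʳ (+ vpℕ p ℤ.∣ U t n ∣)))

  -- For p ∣ d and n = c d', lifting the exponent gives ν_p (U n) = ν_p s' + ν_p c = ν_p (s' n / d').
  vpℚ-agree : ∀ {p} n → 1 ≤ n → p ∈ P → d' ∣ n → vpℚ p (U t n ℚ./ 1) ≡ vpℚ p ((s' * + n) ℚ./ d')
  vpℚ-agree {p} n n≥1 p∈P (ℕD.divides c n≡cd') = begin
      vpℚ p (U t n ℚ./ 1)            ≡⟨ vpℚ-U n n≥1 pr ⟩
      + vpℕ p ℤ.∣ U t n ∣            ≡⟨ cong +_ vp-Un ⟩
      + A + + C                      ≡⟨ ring (+ A) (+ C) (+ D) ⟩
      + A + (+ C + + D) - + D        ≡⟨ cong (λ x → + x - + D) (sym vp-s'n) ⟩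
      + vpℕ p ℤ.∣ s' * + n ∣ - + D   ≡⟨ sym (vpℚ-/ (s' * + n) d' pr s'n≠0) ⟩
      vpℚ p ((s' * + n) ℚ./ d') ∎
    where
    open ≡-Reasoning
    pr = proj₁ (∈P p∈P)
    A = vpℕ p ℤ.∣ s' ∣
    C = vpℕ p c
    D = vpℕ p d'
    c≥1 : 1 ≤ c
    c≥1 = proj₁ (1≤*⁻ c d' (subst (1 ≤_) n≡cd' n≥1))
    vp-Un : vpℕ p ℤ.∣ U t n ∣ ≡ A ℕ.+ C
    vp-Un = trans (cong (λ z → vpℕ p ℤ.∣ U t z ∣) n≡cd')
      (LiftingTheExponent.lte pr (odd-divisor≢2 (proj₂ (∈P p∈P)) d-odd) nz
                              c d' c≥1 d'≥1 (All.lookup Md' p∈P))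
    s'n≠0 : 1 ≤ ℤ.∣ s' * + n ∣
    s'n≠0 = subst (1 ≤_) (sym (ℤP.abs-* s' (+ n))) (1≤* (nz d' d'≥1) n≥1)
    vp-s'n : vpℕ p ℤ.∣ s' * + n ∣ ≡ A ℕ.+ (C ℕ.+ D)
    vp-s'n = trans (cong (vpℕ p) (ℤP.abs-* s' (+ n)))
      (trans (vp-* pr (nz d' d'≥1) n≥1) (cong (A ℕ.+_) (trans (cong (vpℕ p) n≡cd') (vp-* pr c≥1 d'≥1))))
    ring : ∀ a c d → a + c ≡ a + (c + d) - d
    ring = solve-∀

  νd-multiple : ∀ n → 1 ≤ n → d' ∣ n → νd d (U t n ℚ./ 1) ≡ νd d ((s' * + n) ℚ./ d')
  νd-multiple n n≥1 d'∣n = cong minList (map-cong-local (All.tabulate (λ {p} p∈P →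
    cong (λ z → floorDiv z (vpℕ p d)) (vpℚ-agree n n≥1 p∈P d'∣n))))

  -- Otherwise some prime p ∣ d does not divide U t n; its term vanishes, and all terms are ≥ 0.
  νd-non-multiple : ∀ n → 1 ≤ n → ¬ d' ∣ n → νd d (U t n ℚ./ 1) ≡ + 0
  νd-non-multiple n n≥1 d'∤n =
    minList-attained (map f P) (map⁺ f≥0) (subst (_∈ map f P) fp≡0 (∈-map⁺ f p∈P))
    where
    f : ℕ → ℤ
    f p = floorDiv (vpℚ p (U t n ℚ./ 1)) (vpℕ p d)
    witness¬M = find (¬All⇒Any¬ (λ p → + p ℤD.∣? U t n) P (λ Mn → d'∤n (M⇒∣ n Mn)))
    p = proj₁ witness¬M
    p∈P = proj₁ (proj₂ witness¬M)
    pr = proj₁ (∈P p∈P)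
    vp-Un≡0 : vpℕ p ℤ.∣ U t n ∣ ≡ 0
    vp-Un≡0 = vp-coprime (prime⇒2≤ pr) (nz n n≥1) (λ h → proj₂ (proj₂ witness¬M) (∣ᵤ⇒∣ h))
    fp≡0 : f p ≡ + 0
    fp≡0 = trans (cong (λ z → floorDiv z (vpℕ p d)) (trans (vpℚ-U n n≥1 pr) (cong +_ vp-Un≡0)))
                 (floorDiv-zero (vpℕ p d))
    f≥0 : All (λ q → + 0 ℤ.≤ f q) P
    f≥0 = All.tabulate λ {q} q∈P → subst (λ z → + 0 ℤ.≤ floorDiv z (vpℕ q d))
            (sym (vpℚ-U n n≥1 (proj₁ (∈P q∈P)))) (floorDiv-nonneg (vpℕ q ℤ.∣ U t n ∣) (vpℕ q d))

  formula : ∀ n → 1 ≤ n → νd d (U t n ℚ./ 1) ≡ δ d' n ℤ.* νd d ((s' * + n) ℚ./ d')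
  formula n n≥1 = by-cases (d' ℕD.∣? n)
    where
    open ≡-Reasoning
    R = νd d ((s' * + n) ℚ./ d')
    by-cases : Dec (d' ∣ n) → νd d (U t n ℚ./ 1) ≡ δ d' n ℤ.* R
    by-cases (yes d'∣n) = begin
      νd d (U t n ℚ./ 1)    ≡⟨ νd-multiple n n≥1 d'∣n ⟩
      R                     ≡⟨ sym (ℤP.*-identityˡ R) ⟩
      + 1 ℤ.* R             ≡⟨ cong (ℤ._* R) (sym (δ-yes d'∣n)) ⟩
      δ d' n ℤ.* R ∎
    by-cases (no d'∤n) = begin
      νd d (U t n ℚ./ 1)    ≡⟨ νd-non-multiple n n≥1 d'∤n ⟩
      + 0                   ≡⟨ sym (ℤP.*-zeroˡ R) ⟩
      + 0 ℤ.* R             ≡⟨ cong (ℤ._* R) (sym (δ-no d'∤n)) ⟩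
      δ d' n ℤ.* R ∎

theorem14 : (s : ℤ) → + 2 ℤ.≤ s → (d : ℕ) → 3 ≤ d → ¬ (2 ∣ d) →
    ∃[ s' ] ∃[ d' ] Σ (1 ≤ d') λ d'≥1 → d' ≤ d × s' ≢ + 0 ×
      ((n : ℕ) → 1 ≤ n →
        νd d (ℚ._/_ (fib s (- + 1) n) 1)
          ≡ δ d' n ℤ.* νd d (ℚ._/_ (s' ℤ.* + n) d' {{>-nonZero d'≥1}}))
theorem14 s s≥2 d d≥3 d-odd = s' , d' , d'≥1 , d'≤d , s'≢0 , formula
  where open Main s (nondegenerate s s≥2) d (ℕP.≤-trans (s≤s z≤n) d≥3) d-odd
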